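{- For every directed graph $G$, $\mathsf{dnd}(G)\le 4^{\mathsf{vc}(U(G))}+\mathsf{vc}(U(G))$.
   Context: $U(G)$ is the underlying undirected graph of $G$ and $\mathsf{vc}(H)$ is the minimum size of a vertex cover of $H$. For a directed graph $G=(V,E)$ with $N^-(v)=\{x:(x,v)\in E\}$, $N^+(v)=\{x:(v,x)\in E\}$, define $v\sim_{dnd}u$ if $N^-(v)\setminus\{u\}=N^-(u)\setminus\{v\}$, $N^+(v)\setminus\{u\}=N^+(u)\setminus\{v\}$, and $(v,u)\in E\Leftrightarrow(u,v)\in E$; this is an equivalence relation and $\mathsf{dnd}(G)$ is its number of classes. -}

module Defs where

open import Data.Nat using (ℕ; _≤_; _+_; _^_)
open import Data.Fin using (Fin; _≟_)
open import Data.Fin.Subset using (Subset; _∈_; ∣_∣)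
open import Data.Bool using (Bool; true; false; _∧_; _∨_; not)
open import Data.Sum using (_⊎_)
open import Data.Product using (Σ; _×_)
open import Relation.Nullary using (¬_)
open import Relation.Nullary.Decidable using (⌊_⌋)
open import Relation.Binary.PropositionalEquality using (_≡_; _≢_)
open import Function.Bundles using (_⇔_)

record Digraph (n : ℕ) : Set where
  field
    edge     : Fin n → Fin n → Bool
    loopless : ∀ v → edge v v ≡ false
open Digraph public

module _ {n : ℕ} (G : Digraph n) where

  UAdj : Fin n → Fin n → Set
  UAdj u v = (u ≢ v) × ((edge G u v ∨ edge G v u) ≡ true)

  IsVertexCoverU : Subset n → Set
  IsVertexCoverU S = ∀ u v → UAdj u v → (u ∈ S) ⊎ (v ∈ S)

  VcU≡ : ℕ → Set
  VcU≡ k = Σ (Subset n) (λ S → IsVertexCoverU S × ∣ S ∣ ≡ k)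
         × (∀ S → IsVertexCoverU S → k ≤ ∣ S ∣)

  inMinus : Fin n → Fin n → Fin n → Bool
  inMinus v u x = edge G x v ∧ not ⌊ x ≟ u ⌋

  inPlus : Fin n → Fin n → Fin n → Bool
  inPlus v u x = edge G v x ∧ not ⌊ x ≟ u ⌋

  _∼dnd_ : Fin n → Fin n → Set
  v ∼dnd u = (∀ x → inMinus v u x ≡ inMinus u v x)
           × (∀ x → inPlus v u x ≡ inPlus u v x)
           × (edge G v u ≡ true ⇔ edge G u v ≡ true)

  -- dnd(G) = m : the equivalence classes of ∼dnd are in bijection with Fin m,
  -- i.e. there is a surjection f : Fin n → Fin m whose fibres are exactly the classes.
  Dnd≡ : ℕ → Set
  Dnd≡ m = Σ (Fin n → Fin m) (λ f →
             (∀ (c : Fin m) → Σ (Fin n) (λ v → f v ≡ c))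
           × (∀ u v → (f u ≡ f v) ⇔ (u ∼dnd v)))

-- Fix a vertex cover S of U(G).  Its complement is independent, so a vertex
-- v outside S has all its in- and out-neighbours in S, and two such vertices are
-- ∼dnd-equivalent as soon as they have the same in- and out-neighbours inside S.
-- Labelling each v ∉ S by this pair of neighbourhoods (4 ^ |S| possibilities) and
-- each v ∈ S by its position in S (|S| possibilities) therefore gives a map whose
-- fibres lie inside ∼dnd-classes, so there are at most 4 ^ |S| + |S| classes.
module Submission where

open import Defs
open import Data.Nat using (ℕ; _≤_; _+_; _^_)
open import Data.Fin using (Fin; zero; suc; combine; join; splitAt) renaming (_≟_ to _≟ᶠ_)
open import Data.Fin.Properties
  using (suc-injective; combine-injective; splitAt-join; injective⇒≤; 2↔Bool)
open import Data.Fin.Subset using (Subset; _∈_; _∉_; ∣_∣; inside; outside)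
open import Data.Fin.Subset.Properties using (_∈?_)
open import Data.Vec using ([]; _∷_; here; there)
open import Data.Bool using (Bool; true; false; _∧_; _∨_; not)
open import Data.Sum using (_⊎_; inj₁; inj₂)
open import Data.Sum.Properties using (inj₁-injective; inj₂-injective)
open import Data.Product using (Σ; _×_; _,_; proj₁; proj₂)
open import Data.Empty using (⊥-elim)
open import Relation.Nullary using (Dec; yes; no)
open import Relation.Nullary.Decidable using (⌊_⌋; isYes≗does; dec-false)
open import Relation.Binary.PropositionalEquality
open import Function using (_∘_)
open import Function.Bundles using (_⇔_; _↣_; Injection; Equivalence)
open import Function.Construct.Identity using (⇔-id)
open import Function.Properties.Inverse using (↔-sym; ↔⇒↣)

index : ∀ {n} (S : Subset n) {x : Fin n} → x ∈ S → Fin ∣ S ∣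
index (inside  ∷ S) here      = zero
index (inside  ∷ S) (there p) = suc (index S p)
index (outside ∷ S) (there p) = index S p

index-injective : ∀ {n} (S : Subset n) {x y : Fin n} (p : x ∈ S) (q : y ∈ S) →
                  index S p ≡ index S q → x ≡ y
index-injective (inside  ∷ S) here      here      _ = refl
index-injective (inside  ∷ S) (there p) (there q) e = cong suc (index-injective S p q (suc-injective e))
index-injective (outside ∷ S) (there p) (there q) e = cong suc (index-injective S p q e)

funToFinOn : ∀ {n a} (S : Subset n) → (Fin n → Fin a) → Fin (a ^ ∣ S ∣)
funToFinOn []            f = zero
funToFinOn (inside  ∷ S) f = combine (f zero) (funToFinOn S (f ∘ suc))
funToFinOn (outside ∷ S) f = funToFinOn S (f ∘ suc)

funToFinOn-injective : ∀ {n a} (S : Subset n) (f g : Fin n → Fin a) →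
                       funToFinOn S f ≡ funToFinOn S g → ∀ {x} → x ∈ S → f x ≡ g x
funToFinOn-injective (inside ∷ S) f g e here = proj₁ (combine-injective (f zero) _ (g zero) _ e)
funToFinOn-injective (inside ∷ S) f g e (there p) =
  funToFinOn-injective S (f ∘ suc) (g ∘ suc) (proj₂ (combine-injective (f zero) _ (g zero) _ e)) p
funToFinOn-injective (outside ∷ S) f g e (there p) = funToFinOn-injective S (f ∘ suc) (g ∘ suc) e p

join-injective : ∀ m n {i j : Fin m ⊎ Fin n} → join m n i ≡ join m n j → i ≡ j
join-injective m n {i} {j} e = begin
  i                        ≡⟨ splitAt-join m n i ⟨
  splitAt m (join m n i)   ≡⟨ cong (splitAt m) e ⟩
  splitAt m (join m n j)   ≡⟨ splitAt-join m n j ⟩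
  j                        ∎
  where open ≡-Reasoning

-- g is injective on a choice of preimages of the values of f.
surjection-coarser⇒≤ : ∀ {n m p} (f : Fin n → Fin m) (g : Fin n → Fin p) →
                       (∀ c → Σ (Fin n) (λ v → f v ≡ c)) →
                       (∀ u v → g u ≡ g v → f u ≡ f v) → m ≤ p
surjection-coarser⇒≤ {n} {m} {p} f g surj coarser = injective⇒≤ {f = g∘rep} g∘rep-injective
  where
  rep : Fin m → Fin n
  rep c = proj₁ (surj c)
  g∘rep : Fin m → Fin p
  g∘rep c = g (rep c)
  g∘rep-injective : ∀ {c d} → g∘rep c ≡ g∘rep d → c ≡ d
  g∘rep-injective {c} {d} e =
    trans (sym (proj₂ (surj c))) (trans (coarser (rep c) (rep d) e) (proj₂ (surj d)))

bool↣fin2 : Bool ↣ Fin 2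
bool↣fin2 = ↔⇒↣ (↔-sym 2↔Bool)

open Injection bool↣fin2 using () renaming (to to bit; injective to bit-injective)

∼dnd-refl : ∀ {n} (G : Digraph n) v → _∼dnd_ G v v
∼dnd-refl G v = (λ _ → refl) , (λ _ → refl) , ⇔-id _

module _ {n} (G : Digraph n) (S : Subset n) (cover : IsVertexCoverU G S) where

  edge-outside : ∀ {a b} → a ∉ S → b ∉ S → edge G a b ≡ false
  edge-outside {a} {b} a∉ b∉ with a ≟ᶠ b
  ... | yes refl = loopless G a
  ... | no a≢b with edge G a b in ab
  ... | false = refl
  ... | true with cover a b (a≢b , cong (_∨ edge G b a) ab)
  ...   | inj₁ a∈ = ⊥-elim (a∉ a∈)
  ...   | inj₂ b∈ = ⊥-elim (b∉ b∈)

  ∼dnd-outside : ∀ {v w} → v ∉ S → w ∉ S →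
                 (∀ {x} → x ∈ S → edge G x v ≡ edge G x w) →
                 (∀ {x} → x ∈ S → edge G v x ≡ edge G w x) → _∼dnd_ G v w
  ∼dnd-outside {v} {w} v∉ w∉ in≡ out≡ = in-agree , out-agree , nonadjacent
    where
    ≟-outside : ∀ {x u} → x ∈ S → u ∉ S → ⌊ x ≟ᶠ u ⌋ ≡ false
    ≟-outside {x} {u} x∈ u∉ = trans (isYes≗does (x ≟ᶠ u)) (dec-false (x ≟ᶠ u) λ { refl → u∉ x∈ })

    in-agree : ∀ x → inMinus G v w x ≡ inMinus G w v x
    in-agree x with x ∈? S
    ... | yes x∈ = cong₂ _∧_ (in≡ x∈) (cong not (trans (≟-outside x∈ w∉) (sym (≟-outside x∈ v∉))))
    ... | no x∉ rewrite edge-outside x∉ v∉ | edge-outside x∉ w∉ = refl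

    out-agree : ∀ x → inPlus G v w x ≡ inPlus G w v x
    out-agree x with x ∈? S
    ... | yes x∈ = cong₂ _∧_ (out≡ x∈) (cong not (trans (≟-outside x∈ w∉) (sym (≟-outside x∈ v∉))))
    ... | no x∉ rewrite edge-outside v∉ x∉ | edge-outside w∉ x∉ = refl

    nonadjacent : (edge G v w ≡ true) ⇔ (edge G w v ≡ true)
    nonadjacent rewrite edge-outside v∉ w∉ | edge-outside w∉ v∉ = ⇔-id _

  adjacency : Fin n → Fin n → Fin 4
  adjacency v x = combine (bit (edge G x v)) (bit (edge G v x))

  profile : Fin n → Fin (4 ^ ∣ S ∣)
  profile v = funToFinOn S (adjacency v)

  profile-≡⇒∼dnd : ∀ {v w} → v ∉ S → w ∉ S → profile v ≡ profile w → _∼dnd_ G v w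
  profile-≡⇒∼dnd {v} {w} v∉ w∉ e =
    ∼dnd-outside v∉ w∉ (λ x∈ → bit-injective (proj₁ (adjacency-≡ x∈)))
                       (λ x∈ → bit-injective (proj₂ (adjacency-≡ x∈)))
    where
    adjacency-≡ : ∀ {x} → x ∈ S →
                  (bit (edge G x v) ≡ bit (edge G x w)) × (bit (edge G v x) ≡ bit (edge G w x))
    adjacency-≡ x∈ = combine-injective _ _ _ _ (funToFinOn-injective S _ _ e x∈)

  classify : (v : Fin n) → Dec (v ∈ S) → Fin (4 ^ ∣ S ∣) ⊎ Fin ∣ S ∣
  classify v (yes v∈) = inj₂ (index S v∈)
  classify v (no v∉)  = inj₁ (profile v)

  classify-≡⇒∼dnd : ∀ v w (v∈? : Dec (v ∈ S)) (w∈? : Dec (w ∈ S)) →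
                    classify v v∈? ≡ classify w w∈? → _∼dnd_ G v w
  classify-≡⇒∼dnd v w (yes v∈) (yes w∈) e
    with refl ← index-injective S v∈ w∈ (inj₂-injective e) = ∼dnd-refl G v
  classify-≡⇒∼dnd v w (no v∉) (no w∉) e = profile-≡⇒∼dnd v∉ w∉ (inj₁-injective e)

  label : Fin n → Fin (4 ^ ∣ S ∣ + ∣ S ∣)
  label v = join _ _ (classify v (v ∈? S))

  label-≡⇒∼dnd : ∀ {v w} → label v ≡ label w → _∼dnd_ G v w
  label-≡⇒∼dnd {v} {w} e = classify-≡⇒∼dnd v w (v ∈? S) (w ∈? S) (join-injective _ _ e)

proposition4 : ∀ (n : ℕ) (G : Digraph n) (k m : ℕ) → VcU≡ G k → Dnd≡ G m → m ≤ 4 ^ k + k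
proposition4 n G k m ((S , cover , refl) , _) (f , surj , f≡⇔∼dnd) =
  surjection-coarser⇒≤ f (label G S cover) surj
    (λ u v e → Equivalence.from (f≡⇔∼dnd u v) (label-≡⇒∼dnd G S cover e))
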